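{- Let $\mathbb{F}$ be a field of characteristic two. There exists an injective group homomorphism from the Klein four-group $V=\mathbb{Z}/2\mathbb{Z}\times\mathbb{Z}/2\mathbb{Z}$ into the Nottingham group $\mathcal{N}(\mathbb{F})$ such that every nontrivial element of the image has depth $1$ (i.e. lower break sequence $(1)$) if and only if $\mathbb{F}\neq\mathbb{F}_2$.
   Context: For a field $\mathbb{F}$, the Nottingham group $\mathcal{N}(\mathbb{F})$ is the group of power series $\sigma(t)\in\mathbb{F}[[t]]$ of the form $t+O(t^2)$ under composition. The depth of $\sigma\ne t$ is $\mathrm{ord}_t(\sigma(t)-t)-1$; an element of order $2$ has lower break sequence $(d)$ where $d$ is its depth. -}

module Defs where

open import Level using (Level; _⊔_)
open import Algebra.Bundles using (CommutativeRing)
open import Data.Nat using (ℕ; zero; suc; _∸_; _≤_)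
open import Data.Bool using (Bool; true; false; _xor_)
open import Data.Product using (Σ; ∃; _×_; _,_)
open import Relation.Nullary using (¬_)
open import Relation.Binary.PropositionalEquality using (_≡_; _≢_)

V : Set
V = Bool × Bool

_⊕_ : V → V → V
(a , b) ⊕ (c , d) = (a xor c) , (b xor d)

eV : V
eV = false , false

module FieldTheory {c ℓ : Level} (R : CommutativeRing c ℓ) where
  open CommutativeRing R

  record IsField : Set (c ⊔ ℓ) where
    field
      0≉1     : ¬ (0# ≈ 1#)
      inverse : ∀ x → ¬ (x ≈ 0#) → ∃ λ y → x * y ≈ 1#

  Char2 : Set ℓ
  Char2 = 1# + 1# ≈ 0#

  -- F ≠ F₂: F is strictly larger than its prime field {0,1}.
  NotF₂ : Set (c ⊔ ℓ)
  NotF₂ = ∃ λ a → ¬ (a ≈ 0#) × ¬ (a ≈ 1#)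

  Series : Set c
  Series = ℕ → Carrier

  _≈ₛ_ : Series → Series → Set ℓ
  σ ≈ₛ τ = ∀ n → σ n ≈ τ n

  sumTo : ℕ → (ℕ → Carrier) → Carrier
  sumTo zero    f = 0#
  sumTo (suc n) f = sumTo n f + f n

  _·ₛ_ : Series → Series → Series
  (σ ·ₛ τ) n = sumTo (suc n) (λ i → σ i * τ (n ∸ i))

  oneₛ : Series
  oneₛ zero    = 1#
  oneₛ (suc _) = 0#

  tₛ : Series
  tₛ zero          = 0#
  tₛ (suc zero)    = 1#
  tₛ (suc (suc _)) = 0#

  powₛ : Series → ℕ → Series
  powₛ τ zero    = oneₛ
  powₛ τ (suc k) = τ ·ₛ powₛ τ k

  -- composition σ(τ(t)), for τ with zero constant term:
  -- [t^n] σ(τ(t)) = Σ_{k ≤ n} σ_k [t^n] τ(t)^k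
  _∘ₛ_ : Series → Series → Series
  (σ ∘ₛ τ) n = sumTo (suc n) (λ k → σ k * powₛ τ k n)

  InNottingham : Series → Set ℓ
  InNottingham σ = (σ 0 ≈ 0#) × (σ 1 ≈ 1#)

  -- σ has depth d: ord_t(σ(t) - t) = d + 1, i.e. ord_t(σ(t) - t) - 1 = d
  HasDepth : Series → ℕ → Set ℓ
  HasDepth σ d = (∀ i → i ≤ d → σ i - tₛ i ≈ 0#) × ¬ (σ (suc d) - tₛ (suc d) ≈ 0#)

  KleinDepth1Embedding : Set (c ⊔ ℓ)
  KleinDepth1Embedding =
    Σ (V → Series) λ φ →
        (∀ v → InNottingham (φ v))
      × (∀ v w → φ (v ⊕ w) ≈ₛ (φ v ∘ₛ φ w))
      × (∀ v w → φ v ≈ₛ φ w → v ≡ w)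
      × (∀ v → v ≢ eV → HasDepth (φ v) 1)

{-# OPTIONS --safe #-}
-- The series m_a = t/(1 + a t) compose additively: m_a ∘ m_b = m_{a+b}, since
-- 1/m_a(t) = 1/t + a.  Hence an additive injective map u : V → F gives the
-- embedding v ↦ m_{u v}, whose nontrivial elements have t²-coefficient -u v ≠ 0,
-- i.e. depth 1.  Conversely, the t²-coefficient is additive under composition
-- in N(F) and nonzero exactly at depth 1, so any depth-1 embedding yields such
-- a map u.  In characteristic 2 such a map exists iff F ≠ F₂: the images of
-- (1,0) and (0,1) are distinct and nonzero, so their ratio lies outside {0,1};
-- conversely u (x , y) = x + y a works for any a ∉ {0,1}.
module Submission where

open import Level using (_⊔_)
open import Defs
open import Algebra.Bundles using (CommutativeRing)
open import Function.Base using (_∘_)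
open import Function.Bundles using (_⇔_; mk⇔)
open import Data.Nat using (ℕ; zero; suc; _∸_; _≤_; _<_; s≤s)
open import Data.Nat.Properties using (n<1+n; m<n⇒m<1+n; m∸n≤m; n∸n≡0; ∸-monoʳ-<; 0<1+n; ≤-trans)
open import Data.Bool using (Bool; true; false; _xor_)
import Data.Bool.Properties as Bool
open import Data.Product using (Σ; _×_; _,_; proj₁; proj₂)
open import Data.Product.Properties using (≡-dec)
open import Data.Empty using (⊥-elim)
open import Relation.Nullary using (¬_; yes; no)
open import Relation.Binary.Definitions using (DecidableEquality)
open import Relation.Binary.PropositionalEquality using (_≡_; _≢_; cong; cong₂) renaming (refl to ≡-refl)

module SumTo {c ℓ} (R : CommutativeRing c ℓ) where
  open CommutativeRing R
  open FieldTheory R using (sumTo)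
  open import Algebra.Properties.CommutativeSemigroup +-commutativeSemigroup using (interchange)

  sumTo-cong : ∀ n {f g : ℕ → Carrier} → (∀ i → i < n → f i ≈ g i) → sumTo n f ≈ sumTo n g
  sumTo-cong zero    f≈g = refl
  sumTo-cong (suc n) f≈g = +-cong (sumTo-cong n (λ i i<n → f≈g i (m<n⇒m<1+n i<n))) (f≈g n (n<1+n n))

  sumTo-zero : ∀ n {f : ℕ → Carrier} → (∀ i → i < n → f i ≈ 0#) → sumTo n f ≈ 0#
  sumTo-zero zero    f≈0 = refl
  sumTo-zero (suc n) f≈0 =
    trans (+-cong (sumTo-zero n (λ i i<n → f≈0 i (m<n⇒m<1+n i<n))) (f≈0 n (n<1+n n))) (+-identityʳ 0#)

  sumTo-+ : ∀ n (f g : ℕ → Carrier) → sumTo n f + sumTo n g ≈ sumTo n (λ i → f i + g i)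
  sumTo-+ zero    f g = +-identityˡ 0#
  sumTo-+ (suc n) f g = trans (interchange _ _ _ _) (+-congʳ (sumTo-+ n f g))

  *-distribˡ-sumTo : ∀ n x (f : ℕ → Carrier) → x * sumTo n f ≈ sumTo n (λ i → x * f i)
  *-distribˡ-sumTo zero    x f = zeroʳ x
  *-distribˡ-sumTo (suc n) x f = trans (distribˡ x _ _) (+-congʳ (*-distribˡ-sumTo n x f))

  sumTo-sucˡ : ∀ n (f : ℕ → Carrier) → sumTo (suc n) f ≈ f 0 + sumTo n (λ i → f (suc i))
  sumTo-sucˡ zero    f = trans (+-identityˡ _) (sym (+-identityʳ _))
  sumTo-sucˡ (suc n) f = trans (+-congʳ (sumTo-sucˡ n f)) (+-assoc _ _ _)

module PowerSeries {c ℓ} (R : CommutativeRing c ℓ) where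
  open CommutativeRing R
  open FieldTheory R
  open SumTo R
  open import Relation.Binary.Reasoning.Setoid setoid
  open import Algebra.Properties.CommutativeSemigroup *-commutativeSemigroup using (x∙yz≈y∙xz)
  open import Algebra.Properties.Group +-group
    using (x≈z//y; x∙y⁻¹≈ε⇒x≈y; x≈y⇒x∙y⁻¹≈ε; ⁻¹-injective; ε⁻¹≈ε)
  open import Algebra.Properties.AbelianGroup +-abelianGroup using (⁻¹-∙-comm)
  open import Algebra.Properties.Ring ring using (-‿distribˡ-*)

  oneₛ-∸ : ∀ {i n} → i < n → oneₛ (n ∸ i) ≈ 0#
  oneₛ-∸ {zero}  {suc n} _         = refl
  oneₛ-∸ {suc i} {suc n} (s≤s i<n) = oneₛ-∸ i<n

  ·ₛ-identityʳ : ∀ τ → (τ ·ₛ oneₛ) ≈ₛ τ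
  ·ₛ-identityʳ τ n = begin
    sumTo n (λ i → τ i * oneₛ (n ∸ i)) + τ n * oneₛ (n ∸ n)
      ≈⟨ +-cong (sumTo-zero n (λ i i<n → trans (*-congˡ (oneₛ-∸ i<n)) (zeroʳ _))) (*-congˡ lastOne) ⟩
    0# + τ n * 1#
      ≈⟨ trans (+-identityˡ _) (*-identityʳ _) ⟩
    τ n ∎
    where
    lastOne : oneₛ (n ∸ n) ≈ 1#
    lastOne rewrite n∸n≡0 n = refl

  module _ {τ : Series} (τ₀≈0 : τ 0 ≈ 0#) where

    powₛ-vanish : ∀ k n → n < k → powₛ τ k n ≈ 0#
    powₛ-vanish (suc k) n n<1+k = sumTo-zero (suc n) (term n n<1+k)
      where
      term : ∀ n → n < suc k → ∀ i → i < suc n → τ i * powₛ τ k (n ∸ i) ≈ 0#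
      term n       _           zero    _ = trans (*-congʳ τ₀≈0) (zeroˡ _)
      term zero    _           (suc i) (s≤s ())
      term (suc n) (s≤s n<k)   (suc i) _ =
        trans (*-congˡ (powₛ-vanish k (n ∸ i) (≤-trans (s≤s (m∸n≤m n i)) n<k))) (zeroʳ _)

    powₛ-diagonal : τ 1 ≈ 1# → ∀ k → powₛ τ k k ≈ 1#
    powₛ-diagonal τ₁≈1 zero    = refl
    powₛ-diagonal τ₁≈1 (suc k) = begin
      sumTo (suc (suc k)) (λ i → τ i * powₛ τ k (suc k ∸ i))
        ≈⟨ trans (sumTo-sucˡ (suc k) _) (+-congˡ (sumTo-sucˡ k _)) ⟩
      τ 0 * powₛ τ k (suc k) + (τ 1 * powₛ τ k k + sumTo k (λ i → τ (suc (suc i)) * powₛ τ k (k ∸ suc i)))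
        ≈⟨ +-cong (trans (*-congʳ τ₀≈0) (zeroˡ _))
                  (+-cong (*-cong τ₁≈1 (powₛ-diagonal τ₁≈1 k)) (sumTo-zero k high)) ⟩
      0# + (1# * 1# + 0#)
        ≈⟨ trans (+-identityˡ _) (trans (+-identityʳ _) (*-identityˡ 1#)) ⟩
      1# ∎
      where
      high : ∀ i → i < k → τ (suc (suc i)) * powₛ τ k (k ∸ suc i) ≈ 0#
      high i i<k = trans (*-congˡ (powₛ-vanish k (k ∸ suc i) (∸-monoʳ-< 0<1+n i<k))) (zeroʳ _)

  ∘ₛ-coeff₂ : ∀ σ τ → σ 1 ≈ 1# → InNottingham τ → (σ ∘ₛ τ) 2 ≈ τ 2 + σ 2
  ∘ₛ-coeff₂ σ τ σ₁≈1 (τ₀≈0 , τ₁≈1) = begin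
    ((0# + σ 0 * oneₛ 2) + σ 1 * powₛ τ 1 2) + σ 2 * powₛ τ 2 2
      ≈⟨ +-cong (+-cong (trans (+-identityˡ _) (zeroʳ _)) (*-cong σ₁≈1 (·ₛ-identityʳ τ 2)))
                (*-congˡ (powₛ-diagonal {τ} τ₀≈0 τ₁≈1 2)) ⟩
    (0# + 1# * τ 2) + σ 2 * 1#
      ≈⟨ +-cong (trans (+-identityˡ _) (*-identityˡ _)) (*-identityʳ _) ⟩
    τ 2 + σ 2 ∎

  shiftₛ : Series → Series
  shiftₛ σ n = σ (suc n)

  -- [t^n] of t / (1 + a t) is (-a)^(n-1) for n ≥ 1.
  möbius : Carrier → Series
  möbius a zero          = 0#
  möbius a (suc zero)    = 1#
  möbius a (suc (suc n)) = - a * möbius a (suc n)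

  möbius-cong : ∀ {a b} → a ≈ b → möbius a ≈ₛ möbius b
  möbius-cong a≈b zero          = refl
  möbius-cong a≈b (suc zero)    = refl
  möbius-cong a≈b (suc (suc n)) = *-cong (-‿cong a≈b) (möbius-cong a≈b (suc n))

  möbius-coeff₂ : ∀ a → möbius a 2 ≈ - a
  möbius-coeff₂ a = *-identityʳ (- a)

  möbius-injective : ∀ {a b} → möbius a ≈ₛ möbius b → a ≈ b
  möbius-injective {a} {b} eq = ⁻¹-injective (trans (sym (möbius-coeff₂ a)) (trans (eq 2) (möbius-coeff₂ b)))

  ≈ₛ-möbius : ∀ {a s} → s 0 ≈ 0# → s 1 ≈ 1# → (∀ n → s (suc (suc n)) ≈ - a * s (suc n)) → s ≈ₛ möbius a
  ≈ₛ-möbius s₀≈0 s₁≈1 rec zero          = s₀≈0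
  ≈ₛ-möbius s₀≈0 s₁≈1 rec (suc zero)    = s₁≈1
  ≈ₛ-möbius {s = s} s₀≈0 s₁≈1 rec (suc (suc n)) =
    trans (rec n) (*-congˡ (≈ₛ-möbius {s = s} s₀≈0 s₁≈1 rec (suc n)))

  -- (1 + b t) · t/(1 + b t) = t, read off at t^(n+1).
  möbius-·ₛ : ∀ b ρ n → (möbius b ·ₛ ρ) (suc n) + b * (möbius b ·ₛ ρ) n ≈ ρ n
  möbius-·ₛ b ρ n = begin
    (möbius b ·ₛ ρ) (suc n) + b * (möbius b ·ₛ ρ) n
      ≈⟨ +-cong (sumTo-sucˡ (suc n) _) (*-distribˡ-sumTo (suc n) b _) ⟩
    (0# * ρ (suc n) + sumTo (suc n) (λ j → τ (suc j) * ρ (n ∸ j))) + sumTo (suc n) (λ j → b * (τ j * ρ (n ∸ j)))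
      ≈⟨ +-congʳ (trans (+-congʳ (zeroˡ _)) (+-identityˡ _)) ⟩
    sumTo (suc n) (λ j → τ (suc j) * ρ (n ∸ j)) + sumTo (suc n) (λ j → b * (τ j * ρ (n ∸ j)))
      ≈⟨ trans (sumTo-+ (suc n) _ _) (sumTo-sucˡ n _) ⟩
    (1# * ρ n + b * (0# * ρ n)) + sumTo n (λ j → g (suc j))
      ≈⟨ +-cong (trans (+-cong (*-identityˡ _) (trans (*-congˡ (zeroˡ _)) (zeroʳ b))) (+-identityʳ _))
                (sumTo-zero n (λ j _ → cancels j)) ⟩
    ρ n + 0#
      ≈⟨ +-identityʳ _ ⟩
    ρ n ∎
    where
    τ : Series
    τ = möbius b
    g : ℕ → Carrier
    g j = τ (suc j) * ρ (n ∸ j) + b * (τ j * ρ (n ∸ j))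
    cancels : ∀ j → g (suc j) ≈ 0#
    cancels j = begin
      (- b * τ (suc j)) * x + b * (τ (suc j) * x) ≈⟨ +-congʳ (*-assoc _ _ _) ⟩
      - b * (τ (suc j) * x) + b * (τ (suc j) * x) ≈⟨ distribʳ _ _ _ ⟨
      (- b + b) * (τ (suc j) * x)                 ≈⟨ trans (*-congʳ (-‿inverseˡ b)) (zeroˡ _) ⟩
      0# ∎
      where x = ρ (n ∸ suc j)

  ∘ₛ-möbius-shift : ∀ σ b → σ 0 ≈ 0# → ∀ n →
    (σ ∘ₛ möbius b) (suc n) + b * (σ ∘ₛ möbius b) n ≈ (shiftₛ σ ∘ₛ möbius b) n
  ∘ₛ-möbius-shift σ b σ₀≈0 n = begin
    sumTo (suc (suc n)) (λ k → σ k * P k (suc n)) + b * sumTo (suc n) (λ k → σ k * P k n)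
      ≈⟨ +-congˡ (*-congˡ extend) ⟩
    sumTo (suc (suc n)) (λ k → σ k * P k (suc n)) + b * sumTo (suc (suc n)) (λ k → σ k * P k n)
      ≈⟨ +-congˡ (*-distribˡ-sumTo (suc (suc n)) b _) ⟩
    sumTo (suc (suc n)) (λ k → σ k * P k (suc n)) + sumTo (suc (suc n)) (λ k → b * (σ k * P k n))
      ≈⟨ trans (sumTo-+ (suc (suc n)) _ _) (sumTo-cong (suc (suc n)) (λ k _ → factor k)) ⟩
    sumTo (suc (suc n)) (λ k → σ k * (P k (suc n) + b * P k n))
      ≈⟨ sumTo-sucˡ (suc n) _ ⟩
    σ 0 * (P 0 (suc n) + b * P 0 n) + sumTo (suc n) (λ j → σ (suc j) * (P (suc j) (suc n) + b * P (suc j) n))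
      ≈⟨ +-cong (trans (*-congʳ σ₀≈0) (zeroˡ _))
                (sumTo-cong (suc n) (λ j _ → *-congˡ (möbius-·ₛ b (P j) n))) ⟩
    0# + (shiftₛ σ ∘ₛ möbius b) n
      ≈⟨ +-identityˡ _ ⟩
    (shiftₛ σ ∘ₛ möbius b) n ∎
    where
    P : ℕ → Series
    P = powₛ (möbius b)
    extend : sumTo (suc n) (λ k → σ k * P k n) ≈ sumTo (suc (suc n)) (λ k → σ k * P k n)
    extend = sym (trans (+-congˡ (trans (*-congˡ (powₛ-vanish refl (suc n) n (n<1+n n))) (zeroʳ _)))
                        (+-identityʳ _))
    factor : ∀ k → σ k * P k (suc n) + b * (σ k * P k n) ≈ σ k * (P k (suc n) + b * P k n)
    factor k = trans (+-congˡ (x∙yz≈y∙xz b (σ k) (P k n))) (sym (distribˡ _ _ _))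

  shift-möbius-∘ₛ : ∀ a τ n → (shiftₛ (möbius a) ∘ₛ τ) (suc n) ≈ - a * (möbius a ∘ₛ τ) (suc n)
  shift-möbius-∘ₛ a τ n = trans (sumTo-cong (suc (suc n)) (λ k _ → term k))
                                (sym (*-distribˡ-sumTo (suc (suc n)) (- a) _))
    where
    term : ∀ k → möbius a (suc k) * powₛ τ k (suc n) ≈ - a * (möbius a k * powₛ τ k (suc n))
    term zero    = trans (zeroʳ _) (sym (trans (*-congˡ (zeroˡ _)) (zeroʳ _)))
    term (suc k) = *-assoc _ _ _

  x+by≈-ay⇒x≈-[a+b]y : ∀ a b x y → x + b * y ≈ - a * y → x ≈ - (a + b) * y
  x+by≈-ay⇒x≈-[a+b]y a b x y x+by≈-ay = begin
    x                  ≈⟨ x≈z//y x (b * y) (- a * y) x+by≈-ay ⟩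
    - a * y - b * y    ≈⟨ +-congˡ (-‿distribˡ-* b y) ⟩
    - a * y + - b * y  ≈⟨ distribʳ y _ _ ⟨
    (- a + - b) * y    ≈⟨ *-congʳ (⁻¹-∙-comm a b) ⟩
    - (a + b) * y      ∎

  möbius-∘ₛ : ∀ a b → (möbius a ∘ₛ möbius b) ≈ₛ möbius (a + b)
  möbius-∘ₛ a b = ≈ₛ-möbius coeff₀ coeff₁ recurrence
    where
    coeff₀ : (möbius a ∘ₛ möbius b) 0 ≈ 0#
    coeff₀ = trans (+-identityˡ _) (zeroˡ _)
    coeff₁ : (möbius a ∘ₛ möbius b) 1 ≈ 1#
    coeff₁ = trans (+-congʳ (trans (+-identityˡ _) (zeroˡ _))) (trans (+-identityˡ _)
                   (trans (*-identityˡ _) (powₛ-diagonal {möbius b} refl refl 1)))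
    recurrence : ∀ n → (möbius a ∘ₛ möbius b) (suc (suc n)) ≈ - (a + b) * (möbius a ∘ₛ möbius b) (suc n)
    recurrence n = x+by≈-ay⇒x≈-[a+b]y a b _ _
      (trans (∘ₛ-möbius-shift (möbius a) b refl (suc n)) (shift-möbius-∘ₛ a (möbius b) n))

  coeff₂≉0⇒depth₁ : ∀ {σ} → InNottingham σ → ¬ σ 2 ≈ 0# → HasDepth σ 1
  coeff₂≉0⇒depth₁ {σ} (σ₀≈0 , σ₁≈1) σ₂≉0 = low , λ σ₂-0≈0 → σ₂≉0 (x∙y⁻¹≈ε⇒x≈y _ _ σ₂-0≈0)
    where
    low : ∀ i → i ≤ 1 → σ i - tₛ i ≈ 0#
    low zero          _ = x≈y⇒x∙y⁻¹≈ε σ₀≈0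
    low (suc zero)    _ = x≈y⇒x∙y⁻¹≈ε σ₁≈1
    low (suc (suc i)) (s≤s ())

  depth₁⇒coeff₂≉0 : ∀ {σ} → HasDepth σ 1 → ¬ σ 2 ≈ 0#
  depth₁⇒coeff₂≉0 (_ , σ₂-0≉0) σ₂≈0 = σ₂-0≉0 (x≈y⇒x∙y⁻¹≈ε σ₂≈0)

  möbius-depth₁ : ∀ {a} → ¬ a ≈ 0# → HasDepth (möbius a) 1
  möbius-depth₁ {a} a≉0 = coeff₂≉0⇒depth₁ (refl , refl) λ m₂≈0 →
    a≉0 (⁻¹-injective (trans (sym (möbius-coeff₂ a)) (trans m₂≈0 (sym ε⁻¹≈ε))))

module Char2 {c ℓ} (R : CommutativeRing c ℓ) (char2 : FieldTheory.Char2 R) where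
  open CommutativeRing R
  open import Algebra.Properties.Group +-group using (inverseˡ-unique)

  x+x≈0 : ∀ x → x + x ≈ 0#
  x+x≈0 x = begin
    x + x             ≈⟨ +-cong (*-identityʳ x) (*-identityʳ x) ⟨
    x * 1# + x * 1#   ≈⟨ distribˡ x 1# 1# ⟨
    x * (1# + 1#)     ≈⟨ *-congˡ char2 ⟩
    x * 0#            ≈⟨ zeroʳ x ⟩
    0#                ∎
    where open import Relation.Binary.Reasoning.Setoid setoid

  -x≈x : ∀ x → - x ≈ x
  -x≈x x = sym (inverseˡ-unique x x (x+x≈0 x))

  x+y≈0⇒x≈y : ∀ {x y} → x + y ≈ 0# → x ≈ y
  x+y≈0⇒x≈y {x} {y} x+y≈0 = trans (inverseˡ-unique x y x+y≈0) (-x≈x y)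

xor≡false⇒≡ : ∀ x y → x xor y ≡ false → x ≡ y
xor≡false⇒≡ false false _ = ≡-refl
xor≡false⇒≡ true  true  _ = ≡-refl
xor≡false⇒≡ false true  ()
xor≡false⇒≡ true  false ()

⊕≡eV⇒≡ : ∀ v w → v ⊕ w ≡ eV → v ≡ w
⊕≡eV⇒≡ (x , y) (z , t) v⊕w≡e =
  cong₂ _,_ (xor≡false⇒≡ x z (cong proj₁ v⊕w≡e)) (xor≡false⇒≡ y t (cong proj₂ v⊕w≡e))

_≟V_ : DecidableEquality V
_≟V_ = ≡-dec Bool._≟_ Bool._≟_

module Klein {c ℓ} (R : CommutativeRing c ℓ) where
  open CommutativeRing R
  open FieldTheory R
  open PowerSeries R
  open import Algebra.Properties.CommutativeSemigroup +-commutativeSemigroup using (interchange)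
  open import Algebra.Properties.CommutativeSemigroup *-commutativeSemigroup using (x∙yz≈xz∙y)

  AdditiveEmbedding : Set (c ⊔ ℓ)
  AdditiveEmbedding =
    Σ (V → Carrier) λ u → (∀ v w → u (v ⊕ w) ≈ u v + u w) × (∀ v → u v ≈ 0# → v ≡ eV)

  depth₁Embedding⇒additiveEmbedding : KleinDepth1Embedding → AdditiveEmbedding
  depth₁Embedding⇒additiveEmbedding (φ , inN , hom , _ , depth) = (λ v → φ v 2) , additive , kernel
    where
    additive : ∀ v w → φ (v ⊕ w) 2 ≈ φ v 2 + φ w 2
    additive v w = trans (hom v w 2) (trans (∘ₛ-coeff₂ (φ v) (φ w) (proj₂ (inN v)) (inN w)) (+-comm _ _))
    kernel : ∀ v → φ v 2 ≈ 0# → v ≡ eV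
    kernel v φv₂≈0 with v ≟V eV
    ... | yes v≡e = v≡e
    ... | no  v≢e = ⊥-elim (depth₁⇒coeff₂≉0 (depth v v≢e) φv₂≈0)

  additiveEmbedding⇒depth₁Embedding : Char2 → AdditiveEmbedding → KleinDepth1Embedding
  additiveEmbedding⇒depth₁Embedding char2 (u , additive , kernel) =
    φ , (λ v → refl , refl) , hom , injective , λ v v≢e → möbius-depth₁ (v≢e ∘ kernel v)
    where
    open Char2 R char2 using (x+x≈0)
    φ : V → Series
    φ v = möbius (u v)
    hom : ∀ v w → φ (v ⊕ w) ≈ₛ (φ v ∘ₛ φ w)
    hom v w n = trans (möbius-cong (additive v w) n) (sym (möbius-∘ₛ (u v) (u w) n))
    injective : ∀ v w → φ v ≈ₛ φ w → v ≡ w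
    injective v w φv≈φw = ⊕≡eV⇒≡ v w (kernel (v ⊕ w)
      (trans (additive v w) (trans (+-congʳ (möbius-injective φv≈φw)) (x+x≈0 (u w)))))

  distinct-nonzero⇒NotF₂ : IsField → ∀ {x y} → ¬ x ≈ 0# → ¬ y ≈ 0# → ¬ x ≈ y → NotF₂
  distinct-nonzero⇒NotF₂ isField {x} {y} x≉0 y≉0 x≉y with IsField.inverse isField y y≉0
  ... | y⁻¹ , y*y⁻¹≈1 = x * y⁻¹ , (x≉0 ∘ x≈0) , (x≉y ∘ x≈y)
    where
    x≈x*y⁻¹*y : x ≈ (x * y⁻¹) * y
    x≈x*y⁻¹*y = trans (sym (trans (*-congˡ y*y⁻¹≈1) (*-identityʳ x))) (x∙yz≈xz∙y x y y⁻¹)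
    x≈0 : x * y⁻¹ ≈ 0# → x ≈ 0#
    x≈0 a≈0 = trans x≈x*y⁻¹*y (trans (*-congʳ a≈0) (zeroˡ y))
    x≈y : x * y⁻¹ ≈ 1# → x ≈ y
    x≈y a≈1 = trans x≈x*y⁻¹*y (trans (*-congʳ a≈1) (*-identityˡ y))

  additiveEmbedding⇒NotF₂ : IsField → Char2 → AdditiveEmbedding → NotF₂
  additiveEmbedding⇒NotF₂ isField char2 (u , additive , kernel) =
    distinct-nonzero⇒NotF₂ isField (absurd₁₀ ∘ kernel _) (absurd₀₁ ∘ kernel _) distinct
    where
    open Char2 R char2 using (x+x≈0)
    absurd₁₀ : (true , false) ≢ eV
    absurd₁₀ ()
    absurd₀₁ : (false , true) ≢ eV
    absurd₀₁ ()
    absurd₁₁ : (true , true) ≢ eV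
    absurd₁₁ ()
    distinct : ¬ u (true , false) ≈ u (false , true)
    distinct u₁₀≈u₀₁ = absurd₁₁ (kernel (true , true)
      (trans (additive (true , false) (false , true)) (trans (+-congʳ u₁₀≈u₀₁) (x+x≈0 _))))

  NotF₂⇒additiveEmbedding : IsField → Char2 → NotF₂ → AdditiveEmbedding
  NotF₂⇒additiveEmbedding isField char2 (a , a≉0 , a≉1) = u , additive , kernel
    where
    open Char2 R char2 using (x+y≈0⇒x≈y)
    bit : Bool → Carrier
    bit false = 0#
    bit true  = 1#
    u : V → Carrier
    u (x , y) = bit x + bit y * a
    bit-xor : ∀ x y → bit (x xor y) ≈ bit x + bit y
    bit-xor false y     = sym (+-identityˡ _)
    bit-xor true  false = sym (+-identityʳ _)
    bit-xor true  true  = sym char2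
    additive : ∀ v w → u (v ⊕ w) ≈ u v + u w
    additive (x , y) (z , t) =
      trans (+-cong (bit-xor x z) (trans (*-congʳ (bit-xor y t)) (distribʳ a _ _))) (interchange _ _ _ _)
    kernel : ∀ v → u v ≈ 0# → v ≡ eV
    kernel (false , false) _ = ≡-refl
    kernel (true  , false) u≈0 =
      ⊥-elim (IsField.0≉1 isField (trans (sym u≈0) (trans (+-congˡ (zeroˡ a)) (+-identityʳ 1#))))
    kernel (false , true)  u≈0 = ⊥-elim (a≉0 (trans (sym (trans (+-identityˡ _) (*-identityˡ a))) u≈0))
    kernel (true  , true)  u≈0 = ⊥-elim (a≉1 (sym (x+y≈0⇒x≈y (trans (+-congˡ (sym (*-identityˡ a))) u≈0))))

proposition8p1 : ∀ {c ℓ} (F : CommutativeRing c ℓ) → FieldTheory.IsField F → FieldTheory.Char2 F → (FieldTheory.KleinDepth1Embedding F ⇔ FieldTheory.NotF₂ F)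
proposition8p1 F isField char2 =
  mk⇔ (additiveEmbedding⇒NotF₂ isField char2 ∘ depth₁Embedding⇒additiveEmbedding)
      (additiveEmbedding⇒depth₁Embedding char2 ∘ NotF₂⇒additiveEmbedding isField char2)
  where open Klein F
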